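{- For every integer $n\ge 2$, the nim-number of $\mathsf{DNG}(\mathbb{D}_n)$ is $3$ if $n$ is odd and $0$ if $n$ is even.
   Context: $\mathbb{D}_n=\langle r,f\mid r^n=f^2=e,\ rf=fr^{n-1}\rangle$ is the dihedral group of order $2n$. For a nontrivial finite group $G$, the avoidance game $\mathsf{DNG}(G)$ is the impartial game (normal play) whose positions are the subsets $P\subseteq G$ with $\langle P\rangle\neq G$, starting position $\emptyset$, options $\operatorname{Opt}(P)=\{P\cup\{g\}:g\in G\setminus P,\ \langle P\cup\{g\}\rangle\neq G\}$; $\operatorname{nim}(P)=\operatorname{mex}\{\operatorname{nim}(Q):Q\in\operatorname{Opt}(P)\}$ ($\operatorname{mex}$ = least nonnegative integer not in the set) and the nim-number of the game is $\operatorname{nim}(\emptyset)$. -}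

module Defs where

open import Data.Nat using (ℕ; zero; suc; _+_; _∸_; _<_)
open import Data.Nat.DivMod using (_mod_)
open import Data.Fin using (Fin; toℕ)
open import Data.Bool using (Bool; true; false; _xor_)
open import Data.Product using (_×_; _,_; Σ; Σ-syntax)
open import Data.List using (List; _∷_)
open import Data.List.Membership.Propositional using (_∈_; _∉_)
open import Relation.Nullary using (¬_)
open import Relation.Binary.PropositionalEquality using (_≡_; _≢_)

-- The dihedral group D_n of order 2n.
-- The element (a , s) stands for r^a f^s  (a ∈ Z/nZ, s ∈ {0,1}).
-- Using f r^c = r^{-c} f:
--   (r^a f^s)(r^c f^t) = r^{a + (-1)^s c} f^{s xor t}.

addMod : {n : ℕ} → Fin n → Fin n → Fin n
addMod {suc k} a b = (toℕ a + toℕ b) mod (suc k)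

negMod : {n : ℕ} → Fin n → Fin n
negMod {suc k} a = (suc k ∸ toℕ a) mod (suc k)

zeroMod : {n : ℕ} → Fin n → Fin n   -- the zero residue (needs n > 0, witnessed by an element)
zeroMod {suc k} _ = 0 mod (suc k)

D : ℕ → Set
D n = Fin n × Bool

_·_ : {n : ℕ} → D n → D n → D n
(a , false) · (c , t) = addMod a c , t
(a , true)  · (c , t) = addMod a (negMod c) , (true xor t)

inv : {n : ℕ} → D n → D n
inv (a , false) = negMod a , false
inv (a , true)  = a , true

data ⟨_⟩ {n : ℕ} (P : List (D n)) : D n → Set where
  gen  : ∀ {g} → g ∈ P → ⟨ P ⟩ g
  one  : ∀ {g : D n} → ⟨ P ⟩ (zeroMod (Data.Product.proj₁ g) , false)
  mul  : ∀ {g h} → ⟨ P ⟩ g → ⟨ P ⟩ h → ⟨ P ⟩ (g · h)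
  invc : ∀ {g} → ⟨ P ⟩ g → ⟨ P ⟩ (inv g)

Generates : {n : ℕ} → List (D n) → Set
Generates {n} P = (g : D n) → ⟨ P ⟩ g

-- Positions: subsets P with ⟨P⟩ ≠ G (here as lists; order/duplicates
-- are irrelevant since options only add new elements).

Option : {n : ℕ} → List (D n) → List (D n) → Set
Option {n} P Q = Σ[ g ∈ D n ] (g ∉ P × ¬ Generates (g ∷ P) × Q ≡ g ∷ P)

-- NimIs P m : the nim-number of position P is m, i.e.
--   m = mex { nim(Q) : Q ∈ Opt(P) }:
--   every j < m is the nim-number of some option, and
--   every option has a nim-number different from m.
-- (The game is finite, so this relation is functional and total.)
data NimIs {n : ℕ} (P : List (D n)) (m : ℕ) : Set where
  nimIs : (∀ j → j < m → Σ[ Q ∈ List (D n) ] (Option P Q × NimIs Q j))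
        → (∀ Q → Option P Q → Σ[ k ∈ ℕ ] (NimIs Q k × k ≢ m))
        → NimIs P m

-- A position P of DNG(D_n) either contains a reflection f, or consists of rotations generating
-- a subgroup ⟨r^d⟩, where d is the gcd of n and the rotation indices. If f ∈ P, the map
-- x ↦ x·f is a fixed-point-free involution preserving ⟨P⟩; a duplicate-free list closed under an
-- involution has the parity of its number of fixed points, so when |P| is odd some x ∈ P has its
-- partner x·f outside P and adding it is a legal move. As every move flips the parity of |P|, such
-- positions have nim-number |P| mod 2. For even n the involution x ↦ r^(n/2)·x does the same for
-- rotation-only positions, so nim(∅) = 0. For odd n, inversion fixes only the identity among the
-- rotations and so yields a rotation move whenever |P| is even. Hence rotation-only positions
-- with d = 1 (where adding a reflection generates D_n) have nim-number 1 − |P| mod 2. Those with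
-- d > 1 have the options r, f and, when |P| is even, a rotation inside ⟨r^d⟩, of values |P| mod 2,
-- 1 − |P| mod 2 and 2 + |P| mod 2, and every option has one of these values; so their nim-number
-- is 3 − |P| mod 2, and ∅ (where d = n) has nim-number 3.
-- Below, 1 − l mod 2 is written suc l % 2 and 3 − l mod 2 is written 2 + suc l % 2.

module Submission where

open import Defs
open import Data.Nat using (ℕ; _≤_; _%_)
open import Data.List using ([])
open import Relation.Binary.PropositionalEquality using (_≡_)
open import Function.Bundles using (_⇔_)
open import Data.Product using (_×_)

open import Algebra.Bundles using (AbelianGroup)
open import Algebra.Structures using (IsAbelianGroup)
open import Data.Bool as Bool using (true; false)
open import Data.Empty using (⊥-elim)
open import Data.Fin as Fin using (Fin; toℕ)
open import Data.Fin.Properties using (toℕ-fromℕ<; toℕ-injective; toℕ<n)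
open import Data.List using (List; _∷_; length; filter; foldr; allFin; cartesianProduct)
open import Data.List.Membership.Propositional using (_∈_; _∉_; find)
open import Data.List.Membership.Propositional.Properties
  using (∈-filter⁺; ∈-filter⁻; ∈-allFin; ∈-cartesianProduct⁺)
open import Data.List.Properties using (filter-all; filter-reject)
open import Data.List.Relation.Unary.All as All using (All; []; _∷_; all?)
open import Data.List.Relation.Unary.All.Properties using (¬Any⇒All¬; All¬⇒¬Any; ¬All⇒Any¬)
open import Data.List.Relation.Unary.AllPairs using ([]; _∷_)
open import Data.List.Relation.Unary.Any using (here; there)
open import Data.List.Relation.Unary.Unique.Propositional using (Unique)
import Data.List.Relation.Unary.Unique.Propositional.Properties as Unique
open import Data.Nat using (zero; suc; _+_; _*_; _∸_; _/_; _<_; z≤n; s≤s)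
open import Data.Nat.DivMod using (_mod_; m%n<n; m<n⇒m%n≡m; %-distribˡ-+; n%n≡0; m*[n/m]≡n; m/n<m)
open import Data.Nat.Divisibility
  using (_∣_; _∣0; ∣-refl; ∣-trans; ∣-antisym; ∣1⇒≡1; 0∣⇒≡0; ∣m∣n⇒∣m+n; ∣m+n∣m⇒∣n; %-presˡ-∣; m%n≡0⇒n∣m)
open import Data.Nat.GCD
  using (gcd; gcd[m,n]∣m; gcd[m,n]∣n; gcd-greatest; gcd-GCD; gcd-zeroˡ; gcd-zeroʳ; module Bézout)
open import Data.Nat.Induction using (<-wellFounded)
open import Data.Nat.Properties
  using (+-comm; +-assoc; +-suc; +-identityʳ; *-identityʳ; m+[n∸m]≡n; m∸n≤m; n<1⇒n≡0; n<1+n; m<n⇒m<1+n;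
         <⇒≤; <⇒≢; <-irrefl; <-≤-trans; <-cmp; m≤m+n; m≢1+n+m; +-mono-≤; +-mono-<-≤; +-mono-≤-<)
open import Data.Product using (Σ-syntax; ∃-syntax; _,_; proj₁; proj₂)
open import Data.Product.Properties using (≡-dec)
open import Data.Sum using (_⊎_; inj₁; inj₂)
open import Data.Unit using (⊤; tt)
open import Function using (_∘_; case_of_)
open import Function.Bundles using (mk⇔)
open import Induction.WellFounded using (WellFounded; Acc; acc; module Subrelation)
open import Level using (0ℓ)
open import Relation.Binary.Construct.On as On using ()
open import Relation.Binary.Definitions using (DecidableEquality; tri<; tri≈; tri>)
open import Relation.Binary.PropositionalEquality
  using (_≢_; ≢-sym; refl; sym; trans; cong; cong₂; subst; isEquivalence; module ≡-Reasoning)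
open import Relation.Nullary using (¬_; Dec; yes; no; ¬?; contradiction)

parity-suc-≢ : ∀ n → suc n % 2 ≢ n % 2
parity-suc-≢ 0 ()
parity-suc-≢ 1 ()
parity-suc-≢ (suc (suc n)) = parity-suc-≢ n

even⇒suc-odd : ∀ n → n % 2 ≡ 0 → suc n % 2 ≡ 1
even⇒suc-odd 0 _ = refl
even⇒suc-odd 1 ()
even⇒suc-odd (suc (suc n)) = even⇒suc-odd n

odd⇒suc-even : ∀ n → n % 2 ≡ 1 → suc n % 2 ≡ 0
odd⇒suc-even 0 ()
odd⇒suc-even 1 _ = refl
odd⇒suc-even (suc (suc n)) = odd⇒suc-even n

double-even : ∀ n → (n + n) % 2 ≡ 0
double-even zero    = refl
double-even (suc n) = subst (λ x → suc x % 2 ≡ 0) (sym (+-suc n n)) (double-even n)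

<-parity : ∀ n {j} → j < n % 2 → j ≡ 0 × n % 2 ≡ 1
<-parity 0 ()
<-parity 1 j<1 = n<1⇒n≡0 j<1 , refl
<-parity (suc (suc n)) = <-parity n

<2⇒parity : ∀ n {j} → j < 2 → j ≡ n % 2 ⊎ j ≡ suc n % 2
<2⇒parity 0 (s≤s z≤n)       = inj₁ refl
<2⇒parity 0 (s≤s (s≤s z≤n)) = inj₂ refl
<2⇒parity 1 (s≤s z≤n)       = inj₂ refl
<2⇒parity 1 (s≤s (s≤s z≤n)) = inj₁ refl
<2⇒parity (suc (suc n))     = <2⇒parity n

isNoℕ : ∀ {A : Set} → Dec A → ℕ
isNoℕ (yes _) = 0
isNoℕ (no _)  = 1

isNoℕ-mono : ∀ {A B : Set} (a? : Dec A) (b? : Dec B) → (B → A) → isNoℕ a? ≤ isNoℕ b?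
isNoℕ-mono (yes _)  _       _   = z≤n
isNoℕ-mono (no ¬a)  (yes b) b⇒a = contradiction (b⇒a b) ¬a
isNoℕ-mono (no _)   (no _)  _   = s≤s z≤n

isNoℕ-< : ∀ {A B : Set} (a? : Dec A) (b? : Dec B) → A → ¬ B → isNoℕ a? < isNoℕ b?
isNoℕ-< (yes _) (no _)  _ _  = s≤s z≤n
isNoℕ-< (yes _) (yes b) _ ¬b = contradiction b ¬b
isNoℕ-< (no ¬a) _       a _  = contradiction a ¬a

unique-∷ : ∀ {A : Set} {x : A} {xs} → x ∉ xs → Unique xs → Unique (x ∷ xs)
unique-∷ {xs = xs} x∉xs u = ¬Any⇒All¬ xs x∉xs ∷ u

module InvolutionParity {A : Set} (_≟_ : DecidableEquality A)
                        (ι : A → A) (ι-involutive : ∀ x → ι (ι x) ≡ x) where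

  open import Data.List.Membership.DecPropositional _≟_ using (_∈?_)

  Closed : List A → Set
  Closed P = All (λ x → ι x ∈ P) P

  FixedPointFree : List A → Set
  FixedPointFree P = All (λ x → ι x ≢ x) P

  ι-injective : ∀ {x y} → ι x ≡ ι y → x ≡ y
  ι-injective {x} {y} eq = trans (sym (ι-involutive x)) (trans (cong ι eq) (ι-involutive y))

  without : A → List A → List A
  without y = filter (λ x → ¬? (x ≟ y))

  length-without : ∀ {y P} → Unique P → y ∈ P → length P ≡ suc (length (without y P))
  length-without {y} {x ∷ P} (x∉P ∷ _) (here refl) = cong (suc ∘ length) (sym (begin
    without x (x ∷ P)  ≡⟨ filter-reject (λ z → ¬? (z ≟ x)) (λ x≢x → x≢x refl) ⟩
    without x P        ≡⟨ filter-all (λ z → ¬? (z ≟ x)) (All.map (λ x≢z z≡x → x≢z (sym z≡x)) x∉P) ⟩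
    P                  ∎))
    where open ≡-Reasoning
  length-without {y} {x ∷ P} (x∉P ∷ u) (there y∈P) with x ≟ y
  ... | yes refl = contradiction y∈P (All¬⇒¬Any x∉P)
  ... | no _     = cong suc (length-without u y∈P)

  ∈-without⁻ : ∀ {x y P} → x ∈ without y P → x ∈ P × x ≢ y
  ∈-without⁻ {y = y} = ∈-filter⁻ (λ z → ¬? (z ≟ y))

  ∈-without⁺ : ∀ {x y P} → x ∈ P → x ≢ y → x ∈ without y P
  ∈-without⁺ {y = y} = ∈-filter⁺ (λ z → ¬? (z ≟ y))

  fixedPointFree⇒even : ∀ {P} → Unique P → Closed P → FixedPointFree P → length P % 2 ≡ 0
  fixedPointFree⇒even {P} = go (<-wellFounded (length P))
    where
    go : ∀ {P} → Acc _<_ (length P) → Unique P → Closed P → FixedPointFree P → length P % 2 ≡ 0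
    go {[]} _ _ _ _ = refl
    go {x ∷ P} (acc rs) (x∉P ∷ u) (ιx∈x∷P ∷ closed) (ιx≢x ∷ fpf) =
      subst (λ n → suc n % 2 ≡ 0) (sym P≡1+P′) (go (rs P′<1+P) (Unique.filter⁺ _ u) closed′ fpf′)
      where
      ιx∈P : ι x ∈ P
      ιx∈P = case ιx∈x∷P of λ where
        (here ιx≡x)  → contradiction ιx≡x ιx≢x
        (there ιx∈P) → ιx∈P
      P′ = without (ι x) P
      P≡1+P′ : length P ≡ suc (length P′)
      P≡1+P′ = length-without u ιx∈P
      P′<1+P : length P′ < suc (length P)
      P′<1+P = subst (λ n → length P′ < suc n) (sym P≡1+P′) (m<n⇒m<1+n (n<1+n (length P′)))
      closed′ : Closed P′
      closed′ = All.tabulate λ {y} y∈P′ → let y∈P , y≢ιx = ∈-without⁻ y∈P′ in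
        case All.lookup closed y∈P of λ where
          (here ιy≡x)  → contradiction (trans (sym (ι-involutive y)) (cong ι ιy≡x)) y≢ιx
          (there ιy∈P) → ∈-without⁺ ιy∈P λ ιy≡ιx →
            All¬⇒¬Any x∉P (subst (_∈ P) (ι-injective ιy≡ιx) y∈P)
      fpf′ : FixedPointFree P′
      fpf′ = All.tabulate λ y∈P′ → All.lookup fpf (proj₁ (∈-without⁻ y∈P′))

  uniqueFixedPoint⇒odd : ∀ {e P} → Unique P → Closed P → e ∈ P → ι e ≡ e →
                         All (λ x → ι x ≡ x → x ≡ e) P → length P % 2 ≡ 1
  uniqueFixedPoint⇒odd {e} {P} u closed e∈P ιe≡e fixed⇒e =
    subst (λ n → n % 2 ≡ 1) (sym (length-without u e∈P))
      (even⇒suc-odd (length (without e P)) (fixedPointFree⇒even (Unique.filter⁺ _ u) closed′ fpf′))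
    where
    closed′ : Closed (without e P)
    closed′ = All.tabulate λ {y} y∈P′ → let y∈P , y≢e = ∈-without⁻ y∈P′ in
      ∈-without⁺ (All.lookup closed y∈P) (λ ιy≡e → y≢e (ι-injective (trans ιy≡e (sym ιe≡e))))
    fpf′ : FixedPointFree (without e P)
    fpf′ = All.tabulate λ y∈P′ → let y∈P , y≢e = ∈-without⁻ y∈P′ in y≢e ∘ All.lookup fixed⇒e y∈P

  unpaired : ∀ {P} → ¬ Closed P → ∃[ x ] x ∈ P × ι x ∉ P
  unpaired {P} ¬closed = find (¬All⇒Any¬ (λ x → ι x ∈? P) P ¬closed)

  odd⇒unpaired : ∀ {P} → Unique P → FixedPointFree P → length P % 2 ≡ 1 → ∃[ x ] x ∈ P × ι x ∉ P
  odd⇒unpaired {P} u fpf odd with all? (λ x → ι x ∈? P) P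
  ... | yes closed = contradiction (trans (sym (fixedPointFree⇒even u closed fpf)) odd) λ ()
  ... | no ¬closed = unpaired ¬closed

  even⇒unpaired : ∀ {e P} → Unique P → e ∈ P → ι e ≡ e → All (λ x → ι x ≡ x → x ≡ e) P →
                  length P % 2 ≡ 0 → ∃[ x ] x ∈ P × ι x ∉ P
  even⇒unpaired {P = P} u e∈P ιe≡e fixed⇒e even with all? (λ x → ι x ∈? P) P
  ... | yes closed =
    contradiction (trans (sym (uniqueFixedPoint⇒odd u closed e∈P ιe≡e fixed⇒e)) even) λ ()
  ... | no ¬closed = unpaired ¬closed

NimIs-functional : ∀ {n} {P : List (D n)} {i j} → NimIs P i → NimIs P j → i ≡ j
NimIs-functional {i = i} {j} (nimIs below-i options-i) (nimIs below-j options-j) with <-cmp i j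
... | tri≈ _ i≡j _ = i≡j
... | tri< i<j _ _ = let Q , o , Q-i = below-j i i<j ; _ , Q-k , k≢i = options-i Q o in
                     ⊥-elim (k≢i (NimIs-functional Q-k Q-i))
... | tri> _ _ j<i = let Q , o , Q-j = below-i j j<i ; _ , Q-k , k≢j = options-j Q o in
                     ⊥-elim (k≢j (NimIs-functional Q-k Q-j))

NimIs-⇔ : ∀ {n} {P : List (D n)} {v} → NimIs P v → ∀ m → NimIs P m ⇔ m ≡ v
NimIs-⇔ P-v m = mk⇔ (λ P-m → NimIs-functional P-m P-v) (λ { refl → P-v })

module Cyclic (m : ℕ) where

  N : ℕ
  N = suc m

  [_] : ℕ → Fin N
  [ x ] = x mod N

  toℕ-[] : ∀ x → toℕ [ x ] ≡ x % N
  toℕ-[] x = toℕ-fromℕ< (m%n<n x N)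

  []-cong : ∀ x y → x % N ≡ y % N → [ x ] ≡ [ y ]
  []-cong x y eq = toℕ-injective (trans (toℕ-[] x) (trans eq (sym (toℕ-[] y))))

  [toℕ] : ∀ a → [ toℕ a ] ≡ a
  [toℕ] a = toℕ-injective (trans (toℕ-[] (toℕ a)) (m<n⇒m%n≡m (toℕ<n a)))

  [N]≡0 : [ N ] ≡ Fin.zero
  [N]≡0 = []-cong N 0 (n%n≡0 N)

  addMod-[] : ∀ x y → addMod [ x ] [ y ] ≡ [ x + y ]
  addMod-[] x y = []-cong (toℕ [ x ] + toℕ [ y ]) (x + y) (begin
    (toℕ [ x ] + toℕ [ y ]) % N  ≡⟨ cong₂ (λ u v → (u + v) % N) (toℕ-[] x) (toℕ-[] y) ⟩
    (x % N + y % N) % N          ≡⟨ %-distribˡ-+ x y N ⟨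
    (x + y) % N                  ∎)
    where open ≡-Reasoning

  addMod-[]ʳ : ∀ a y → addMod a [ y ] ≡ [ toℕ a + y ]
  addMod-[]ʳ a y = trans (cong (λ b → addMod b [ y ]) (sym ([toℕ] a))) (addMod-[] (toℕ a) y)

  addMod-comm : ∀ a b → addMod a b ≡ addMod b a
  addMod-comm a b = cong [_] (+-comm (toℕ a) (toℕ b))

  addMod-assoc : ∀ a b c → addMod (addMod a b) c ≡ addMod a (addMod b c)
  addMod-assoc a b c = begin
    addMod [ α + β ] c    ≡⟨ addMod-comm [ α + β ] c ⟩
    addMod c [ α + β ]    ≡⟨ addMod-[]ʳ c (α + β) ⟩
    [ γ + (α + β) ]       ≡⟨ cong [_] (trans (+-comm γ (α + β)) (+-assoc α β γ)) ⟩
    [ α + (β + γ) ]       ≡⟨ addMod-[]ʳ a (β + γ) ⟨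
    addMod a [ β + γ ]    ∎
    where
    open ≡-Reasoning
    α = toℕ a
    β = toℕ b
    γ = toℕ c

  addMod-identityˡ : ∀ a → addMod Fin.zero a ≡ a
  addMod-identityˡ = [toℕ]

  addMod-inverseʳ : ∀ a → addMod a (negMod a) ≡ Fin.zero
  addMod-inverseʳ a = begin
    addMod a [ N ∸ toℕ a ]     ≡⟨ addMod-[]ʳ a (N ∸ toℕ a) ⟩
    [ toℕ a + (N ∸ toℕ a) ]    ≡⟨ cong [_] (m+[n∸m]≡n (<⇒≤ (toℕ<n a))) ⟩
    [ N ]                      ≡⟨ [N]≡0 ⟩
    Fin.zero                   ∎
    where open ≡-Reasoning

  isAbelianGroup : IsAbelianGroup _≡_ addMod Fin.zero negMod
  isAbelianGroup = record
    { isGroup = record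
      { isMonoid = record
        { isSemigroup = record
          { isMagma = record { isEquivalence = isEquivalence ; ∙-cong = cong₂ addMod }
          ; assoc = addMod-assoc }
        ; identity = addMod-identityˡ , λ a → trans (addMod-comm a Fin.zero) (addMod-identityˡ a) }
      ; inverse = (λ a → trans (addMod-comm (negMod a) a) (addMod-inverseʳ a)) , addMod-inverseʳ
      ; ⁻¹-cong = cong negMod }
    ; comm = addMod-comm }

  ℤ/N : AbelianGroup 0ℓ 0ℓ
  ℤ/N = record { isAbelianGroup = isAbelianGroup }

module Dihedral (k : ℕ) where

  open Cyclic (suc k) public
  open AbelianGroup ℤ/N using (group; monoid; inverseʳ)
  open import Algebra.Properties.Group group using (//-rightDividesˡ; ⁻¹-involutive)
  open import Algebra.Properties.Monoid monoid using (cancelʳ)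

  index : D N → ℕ
  index g = toℕ (proj₁ g)

  IsRotation : D N → Set
  IsRotation g = proj₂ g ≡ false

  rotation : ℕ → D N
  rotation x = [ x ] , false

  rotation-toℕ : ∀ a → rotation (toℕ a) ≡ (a , false)
  rotation-toℕ a = cong (_, false) ([toℕ] a)

  rotation-+ : ∀ x y → rotation x · rotation y ≡ rotation (x + y)
  rotation-+ x y = cong (_, false) (addMod-[] x y)

  rotation-∸ : ∀ {d u v} → d + v ≡ u → rotation u · inv (rotation v) ≡ rotation d
  rotation-∸ {d} {u} {v} refl = cong (_, false) (begin
    addMod [ d + v ] (negMod [ v ])           ≡⟨ cong (λ a → addMod a (negMod [ v ])) (addMod-[] d v) ⟨
    addMod (addMod [ d ] [ v ]) (negMod [ v ]) ≡⟨ cancelʳ (inverseʳ [ v ]) [ d ] ⟩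
    [ d ]                                      ∎)
    where open ≡-Reasoning

  inv-involutive : ∀ g → inv (inv g) ≡ g
  inv-involutive (a , false) = cong (_, false) (⁻¹-involutive a)
  inv-involutive (a , true)  = refl

  ·-reflection-involutive : ∀ i (g : D N) → (g · (i , true)) · (i , true) ≡ g
  ·-reflection-involutive i (a , false) = cong (_, false) (cancelʳ (inverseʳ i) a)
  ·-reflection-involutive i (a , true)  = cong (_, true) (//-rightDividesˡ i a)

  ·-reflection-≢ : ∀ i (g : D N) → g · (i , true) ≢ g
  ·-reflection-≢ i (a , false) ()
  ·-reflection-≢ i (a , true)  ()

  record IsSubgroup (S : D N → Set) : Set where
    field
      ε-closed   : S (Fin.zero , false)
      ·-closed   : ∀ {g h} → S g → S h → S (g · h)
      inv-closed : ∀ {g} → S g → S (inv g)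

  ⟨⟩-least : ∀ {S P} → IsSubgroup S → All S P → ∀ {g} → ⟨ P ⟩ g → S g
  ⟨⟩-least H SP (gen g∈P) = All.lookup SP g∈P
  ⟨⟩-least H SP one       = IsSubgroup.ε-closed H
  ⟨⟩-least H SP (mul p q) = IsSubgroup.·-closed H (⟨⟩-least H SP p) (⟨⟩-least H SP q)
  ⟨⟩-least H SP (invc p)  = IsSubgroup.inv-closed H (⟨⟩-least H SP p)

  ⟨⟩-isSubgroup : ∀ P → IsSubgroup ⟨ P ⟩
  ⟨⟩-isSubgroup P = record { ε-closed = one {g = Fin.zero , false} ; ·-closed = mul ; inv-closed = invc }

  properSubgroup⇒¬Generates : ∀ {S P g} → IsSubgroup S → All S P → ¬ S g → ¬ Generates P
  properSubgroup⇒¬Generates {g = g} H SP ¬Sg generates = ¬Sg (⟨⟩-least H SP (generates g))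

  ¬Generates-∷ : ∀ {P g} → ⟨ P ⟩ g → ¬ Generates P → ¬ Generates (g ∷ P)
  ¬Generates-∷ {P} g∈⟨P⟩ ¬generates generates =
    ¬generates (λ x → ⟨⟩-least (⟨⟩-isSubgroup P) (g∈⟨P⟩ ∷ All.tabulate gen) (generates x))

  rotations-isSubgroup : IsSubgroup IsRotation
  rotations-isSubgroup = record
    { ε-closed   = refl
    ; ·-closed   = λ { {a , false} {c , false} refl refl → refl }
    ; inv-closed = λ { {a , false} refl → refl }
    }

  rotations-¬Generates : ∀ {P} → All IsRotation P → ¬ Generates P
  rotations-¬Generates rot = properSubgroup⇒¬Generates {g = Fin.zero , true} rotations-isSubgroup rot (λ ())

  ∣-toℕ-[] : ∀ {d x} → d ∣ N → d ∣ x → d ∣ toℕ [ x ]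
  ∣-toℕ-[] {d} {x} d∣N d∣x = subst (d ∣_) (sym (toℕ-[] x)) (%-presˡ-∣ d∣x d∣N)

  ∣-index-negMod : ∀ {d} → d ∣ N → ∀ a → d ∣ toℕ a → d ∣ toℕ (negMod a)
  ∣-index-negMod {d} d∣N a d∣a = ∣-toℕ-[] d∣N (∣m+n∣m⇒∣n d∣a+[N∸a] d∣a)
    where
    d∣a+[N∸a] : d ∣ toℕ a + (N ∸ toℕ a)
    d∣a+[N∸a] = subst (d ∣_) (sym (m+[n∸m]≡n (<⇒≤ (toℕ<n a)))) d∣N

  multiples-isSubgroup : ∀ {d} → d ∣ N → IsSubgroup (λ g → d ∣ index g)
  multiples-isSubgroup {d} d∣N = record
    { ε-closed   = d ∣0
    ; ·-closed   = λ {g} {h} → ·-closed {g} {h}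
    ; inv-closed = λ { {a , false} → ∣-index-negMod d∣N a ; {a , true} d∣a → d∣a }
    }
    where
    ·-closed : ∀ {g h} → d ∣ index g → d ∣ index h → d ∣ index (g · h)
    ·-closed {a , false} {c , t} d∣a d∣c = ∣-toℕ-[] d∣N (∣m∣n⇒∣m+n d∣a d∣c)
    ·-closed {a , true}  {c , t} d∣a d∣c = ∣-toℕ-[] d∣N (∣m∣n⇒∣m+n d∣a (∣-index-negMod d∣N c d∣c))

  multiples-¬Generates : ∀ {d P} → 1 < d → d ∣ N → All (λ g → d ∣ index g) P → ¬ Generates P
  multiples-¬Generates {d} 1<d d∣N d∣P =
    properSubgroup⇒¬Generates {g = rotation 1} (multiples-isSubgroup d∣N) d∣P d∤1
    where
    d∤1 : ¬ d ∣ 1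
    d∤1 d∣1 = <-irrefl (sym (∣1⇒≡1 d∣1)) 1<d

  rotation-* : ∀ {Q a} → ⟨ Q ⟩ (rotation a) → ∀ x → ⟨ Q ⟩ (rotation (x * a))
  rotation-* r zero = one {g = Fin.zero , false}
  rotation-* {Q} {a} r (suc x) = subst ⟨ Q ⟩ (rotation-+ a (x * a)) (mul r (rotation-* r x))

  rotation-gcd : ∀ {Q a b} → ⟨ Q ⟩ (rotation a) → ⟨ Q ⟩ (rotation b) → ⟨ Q ⟩ (rotation (gcd a b))
  rotation-gcd {Q} {a} {b} ra rb with Bézout.identity (gcd-GCD a b)
  ... | Bézout.+- x y eq =
    subst ⟨ Q ⟩ (rotation-∸ {gcd a b} {x * a} {y * b} eq) (mul (rotation-* ra x) (invc (rotation-* rb y)))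
  ... | Bézout.-+ x y eq =
    subst ⟨ Q ⟩ (rotation-∸ {gcd a b} {y * b} {x * a} eq) (mul (rotation-* rb y) (invc (rotation-* ra x)))

  indexGcd : List (D N) → ℕ
  indexGcd = foldr (λ g → gcd (index g)) N

  indexGcd-∣N : ∀ P → indexGcd P ∣ N
  indexGcd-∣N []      = ∣-refl
  indexGcd-∣N (g ∷ P) = ∣-trans (gcd[m,n]∣n (index g) (indexGcd P)) (indexGcd-∣N P)

  indexGcd-cases : ∀ P → indexGcd P ≡ 1 ⊎ 1 < indexGcd P
  indexGcd-cases P with indexGcd P | indexGcd-∣N P
  ... | 0           | 0∣N = contradiction (0∣⇒≡0 0∣N) λ ()
  ... | 1           | _   = inj₁ refl
  ... | suc (suc _) | _   = inj₂ (s≤s (s≤s z≤n))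

  indexGcd-∣index : ∀ P → All (λ g → indexGcd P ∣ index g) P
  indexGcd-∣index []      = []
  indexGcd-∣index (g ∷ P) =
    gcd[m,n]∣m (index g) (indexGcd P) ∷
    All.map (∣-trans (gcd[m,n]∣n (index g) (indexGcd P))) (indexGcd-∣index P)

  rotation-indexGcd : ∀ {Q P} → All IsRotation P → All ⟨ Q ⟩ P → ⟨ Q ⟩ (rotation (indexGcd P))
  rotation-indexGcd {Q} [] [] = subst ⟨ Q ⟩ (cong (_, false) (sym [N]≡0)) (one {g = Fin.zero , false})
  rotation-indexGcd {Q} {(a , false) ∷ P} (refl ∷ rot) (a∈Q ∷ P⊆Q) =
    rotation-gcd {Q} {toℕ a} {indexGcd P} (subst ⟨ Q ⟩ (sym (rotation-toℕ a)) a∈Q) (rotation-indexGcd rot P⊆Q)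

  rotation1-generates-rotations : ∀ {Q} → ⟨ Q ⟩ (rotation 1) → ∀ a → ⟨ Q ⟩ (a , false)
  rotation1-generates-rotations {Q} r₁ a =
    subst ⟨ Q ⟩ (trans (cong rotation (*-identityʳ (toℕ a))) (rotation-toℕ a)) (rotation-* r₁ (toℕ a))

  rotation1+reflection-generate : ∀ {Q t} → ⟨ Q ⟩ (rotation 1) → ⟨ Q ⟩ (t , true) → Generates Q
  rotation1+reflection-generate r₁ f (a , false) = rotation1-generates-rotations r₁ a
  rotation1+reflection-generate {Q} {t} r₁ f (a , true) =
    subst ⟨ Q ⟩ (cong (_, true) (//-rightDividesˡ t a))
      (mul (rotation1-generates-rotations r₁ (addMod a (negMod t))) f)

  indexGcd≡1+reflection-generate : ∀ {P} → All IsRotation P → indexGcd P ≡ 1 →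
                                   ∀ t → Generates ((t , true) ∷ P)
  indexGcd≡1+reflection-generate {P} rot gcd≡1 t = rotation1+reflection-generate r₁ (gen (here refl))
    where
    r₁ : ⟨ (t , true) ∷ P ⟩ (rotation 1)
    r₁ = subst (λ d → ⟨ (t , true) ∷ P ⟩ (rotation d)) gcd≡1
           (rotation-indexGcd rot (All.tabulate (gen ∘ there)))

module AvoidanceGame (k : ℕ) where

  open Dihedral k

  _≟_ : DecidableEquality (D N)
  _≟_ = ≡-dec Fin._≟_ Bool._≟_

  open import Data.List.Membership.DecPropositional _≟_ using (_∈?_)

  elements : List (D N)
  elements = cartesianProduct (allFin N) (false ∷ true ∷ [])

  ∈-elements : ∀ g → g ∈ elements
  ∈-elements (a , false) = ∈-cartesianProduct⁺ {ys = false ∷ true ∷ []} (∈-allFin a) (here refl)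
  ∈-elements (a , true)  = ∈-cartesianProduct⁺ {ys = false ∷ true ∷ []} (∈-allFin a) (there (here refl))

  countAbsent : List (D N) → List (D N) → ℕ
  countAbsent []      P = 0
  countAbsent (x ∷ L) P = isNoℕ (x ∈? P) + countAbsent L P

  countAbsent-∷-≤ : ∀ L g P → countAbsent L (g ∷ P) ≤ countAbsent L P
  countAbsent-∷-≤ []      g P = z≤n
  countAbsent-∷-≤ (x ∷ L) g P =
    +-mono-≤ (isNoℕ-mono (x ∈? g ∷ P) (x ∈? P) there) (countAbsent-∷-≤ L g P)

  countAbsent-∷-< : ∀ L {g P} → g ∉ P → g ∈ L → countAbsent L (g ∷ P) < countAbsent L P
  countAbsent-∷-< (x ∷ L) {g} {P} g∉P (here refl) =
    +-mono-<-≤ (isNoℕ-< (x ∈? g ∷ P) (x ∈? P) (here refl) g∉P) (countAbsent-∷-≤ L g P)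
  countAbsent-∷-< (x ∷ L) {g} {P} g∉P (there g∈L) =
    +-mono-≤-< (isNoℕ-mono (x ∈? g ∷ P) (x ∈? P) there) (countAbsent-∷-< L g∉P g∈L)

  _⊏_ : List (D N) → List (D N) → Set
  Q ⊏ P = Option P Q

  ⊏-wellFounded : WellFounded _⊏_
  ⊏-wellFounded = Subrelation.wellFounded option⇒< (On.wellFounded (countAbsent elements) <-wellFounded)
    where
    option⇒< : ∀ {Q P} → Q ⊏ P → countAbsent elements Q < countAbsent elements P
    option⇒< (g , g∉P , _ , refl) = countAbsent-∷-< elements g∉P (∈-elements g)

  Move : List (D N) → Set
  Move P = Σ[ g ∈ D N ] g ∉ P × ¬ Generates (g ∷ P)

  HasOptionWithNim : List (D N) → ℕ → Set
  HasOptionWithNim P j = Σ[ Q ∈ List (D N) ] Option P Q × NimIs Q j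

  module ParityStrategy
    (Inv      : List (D N) → Set)
    (Inv-∷    : ∀ {g P} → Inv P → Inv (g ∷ P))
    (odd-move : ∀ {P} → Inv P → Unique P → ¬ Generates P → length P % 2 ≡ 1 → Move P)
    where

    nim≡parity : ∀ {P} → Acc _⊏_ P → Inv P → Unique P → ¬ Generates P → NimIs P (length P % 2)
    nim≡parity {P} (acc rs) inv u ¬gen = nimIs below options
      where
      l = length P

      option-nim : ∀ {g} (o : Option P (g ∷ P)) → NimIs (g ∷ P) (suc l % 2)
      option-nim o@(_ , g∉P , ¬gen′ , refl) = nim≡parity (rs o) (Inv-∷ inv) (unique-∷ g∉P u) ¬gen′

      below : ∀ j → j < l % 2 → HasOptionWithNim P j
      below j j<l with <-parity l j<l
      ... | refl , odd with odd-move inv u ¬gen odd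
      ...   | g , g∉P , ¬gen′ = g ∷ P , o , subst (NimIs (g ∷ P)) (odd⇒suc-even l odd) (option-nim o)
        where o = g , g∉P , ¬gen′ , refl

      options : ∀ Q → Option P Q → Σ[ j ∈ ℕ ] NimIs Q j × j ≢ l % 2
      options _ o@(_ , _ , _ , refl) = suc l % 2 , option-nim o , parity-suc-≢ l

  HasReflection : List (D N) → Set
  HasReflection P = ∃[ i ] (i , true) ∈ P

  reflection-or-rotations : ∀ P → HasReflection P ⊎ All IsRotation P
  reflection-or-rotations [] = inj₂ []
  reflection-or-rotations ((a , true) ∷ P) = inj₁ (a , here refl)
  reflection-or-rotations ((a , false) ∷ P) with reflection-or-rotations P
  ... | inj₁ (i , i∈P) = inj₁ (i , there i∈P)
  ... | inj₂ rot       = inj₂ (refl ∷ rot)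

  reflection-move : ∀ {P} → HasReflection P → Unique P → ¬ Generates P → length P % 2 ≡ 1 → Move P
  reflection-move {P} (i , i∈P) u ¬gen odd
    with odd⇒unpaired u (All.tabulate λ {g} _ → ·-reflection-≢ i g) odd
    where open InvolutionParity _≟_ (_· (i , true)) (·-reflection-involutive i)
  ... | g , g∈P , gi∉P = g · (i , true) , gi∉P , ¬Generates-∷ (mul (gen g∈P) (gen i∈P)) ¬gen

  nim-reflection : ∀ {P} → HasReflection P → Unique P → ¬ Generates P → NimIs P (length P % 2)
  nim-reflection = ParityStrategy.nim≡parity HasReflection (λ (i , i∈P) → i , there i∈P) reflection-move
                     (⊏-wellFounded _)

  module EvenOrder (even : N % 2 ≡ 0) where

    open AbelianGroup ℤ/N using (group; monoid)
    open import Algebra.Properties.Monoid monoid using (cancelˡ)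
    open import Algebra.Properties.Group group using (loop)
    open import Algebra.Properties.Loop loop using (identityˡ-unique)

    half : Fin N
    half = [ N / 2 ]

    2*N/2≡N : 2 * (N / 2) ≡ N
    2*N/2≡N = m*[n/m]≡n (m%n≡0⇒n∣m N 2 even)

    half+half≡0 : addMod half half ≡ Fin.zero
    half+half≡0 = begin
      addMod [ N / 2 ] [ N / 2 ]  ≡⟨ addMod-[] (N / 2) (N / 2) ⟩
      [ N / 2 + N / 2 ]           ≡⟨ cong (λ x → [ N / 2 + x ]) (+-identityʳ (N / 2)) ⟨
      [ 2 * (N / 2) ]             ≡⟨ cong [_] 2*N/2≡N ⟩
      [ N ]                       ≡⟨ [N]≡0 ⟩
      Fin.zero                    ∎
      where open ≡-Reasoning

    half≢0 : half ≢ Fin.zero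
    half≢0 half≡0 = contradiction (trans (sym 2*N/2≡N) (cong (2 *_) N/2≡0)) λ ()
      where
      N/2≡0 : N / 2 ≡ 0
      N/2≡0 = begin
        N / 2            ≡⟨ m<n⇒m%n≡m (m/n<m N 2 (s≤s (s≤s z≤n))) ⟨
        N / 2 % N        ≡⟨ toℕ-[] (N / 2) ⟨
        toℕ half         ≡⟨ cong toℕ half≡0 ⟩
        0                ∎
        where open ≡-Reasoning

    shift : D N → D N
    shift g = addMod half (proj₁ g) , proj₂ g

    shift-involutive : ∀ g → shift (shift g) ≡ g
    shift-involutive g = cong (_, proj₂ g) (cancelˡ {half} {half} half+half≡0 (proj₁ g))

    shift-≢ : ∀ g → shift g ≢ g
    shift-≢ g eq = half≢0 (identityˡ-unique half (proj₁ g) (cong proj₁ eq))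

    rotations-move : ∀ {P} → All IsRotation P → Unique P → length P % 2 ≡ 1 → Move P
    rotations-move rot u odd with odd⇒unpaired u (All.tabulate λ {g} _ → shift-≢ g) odd
      where open InvolutionParity _≟_ shift shift-involutive
    ... | g , g∈P , shift-g∉P = shift g , shift-g∉P , rotations-¬Generates (All.lookup rot g∈P ∷ rot)

    odd-move : ∀ {P} → ⊤ → Unique P → ¬ Generates P → length P % 2 ≡ 1 → Move P
    odd-move {P} _ u ¬gen odd with reflection-or-rotations P
    ... | inj₁ reflection = reflection-move reflection u ¬gen odd
    ... | inj₂ rot        = rotations-move rot u odd

    nim[]≡0 : NimIs {N} [] 0
    nim[]≡0 = ParityStrategy.nim≡parity (λ _ → ⊤) _ odd-move
                (⊏-wellFounded []) tt [] (rotations-¬Generates [])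

  module OddOrder (odd : N % 2 ≡ 1) where

    negMod-fixed⇒0 : ∀ (a : Fin N) → negMod a ≡ a → a ≡ Fin.zero
    negMod-fixed⇒0 Fin.zero        _    = refl
    negMod-fixed⇒0 a@(Fin.suc b) -a≡a =
      contradiction (trans (sym odd) (trans (cong (_% 2) (sym α+α≡N)) (double-even α))) (λ ())
      where
      α = toℕ a
      N∸α≡α : N ∸ α ≡ α
      N∸α≡α = begin
        N ∸ α            ≡⟨ m<n⇒m%n≡m (s≤s (m∸n≤m (suc k) (toℕ b))) ⟨
        (N ∸ α) % N      ≡⟨ toℕ-[] (N ∸ α) ⟨
        toℕ (negMod a)   ≡⟨ cong toℕ -a≡a ⟩
        α                ∎
        where open ≡-Reasoning
      α+α≡N : α + α ≡ N
      α+α≡N = trans (cong (α +_) (sym N∸α≡α)) (m+[n∸m]≡n (<⇒≤ (toℕ<n a)))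

    inv-fixed⇒ε : ∀ {g} → IsRotation g → inv g ≡ g → g ≡ (Fin.zero , false)
    inv-fixed⇒ε {a , false} refl eq = cong (_, false) (negMod-fixed⇒0 a (cong proj₁ eq))

    -- The new rotation lies in the subgroup generated by P, so a proper position stays proper.
    rotation-move : ∀ {P} → All IsRotation P → Unique P → length P % 2 ≡ 0 →
                    Σ[ a ∈ Fin N ] (a , false) ∉ P × indexGcd P ∣ toℕ a
    rotation-move {P} rot u even with (Fin.zero , false) ∈? P
    ... | no ε∉P = Fin.zero , ε∉P , indexGcd P ∣0
    ... | yes ε∈P with even⇒unpaired u ε∈P (cong (_, false) [N]≡0) (All.map inv-fixed⇒ε rot) even
      where open InvolutionParity _≟_ inv inv-involutive
    ...   | (a , s) , g∈P , g⁻¹∉P with All.lookup rot g∈P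
    ...     | refl =
      negMod a , g⁻¹∉P , ∣-index-negMod (indexGcd-∣N P) a (All.lookup (indexGcd-∣index P) g∈P)

    nim-rotations-full : ∀ {P} → Acc _⊏_ P → All IsRotation P → indexGcd P ≡ 1 → Unique P →
                         NimIs P (suc (length P) % 2)
    nim-rotations-full {P} (acc rs) rot gcd≡1 u = nimIs below options
      where
      l = length P

      option-nim : ∀ {a} (o : Option P ((a , false) ∷ P)) → NimIs ((a , false) ∷ P) (l % 2)
      option-nim {a} o@(_ , a∉P , _ , refl) =
        nim-rotations-full (rs o) (refl ∷ rot) (trans (cong (gcd (toℕ a)) gcd≡1) (gcd-zeroʳ (toℕ a)))
          (unique-∷ a∉P u)

      below : ∀ j → j < suc l % 2 → HasOptionWithNim P j
      below j j<1+l with <-parity (suc l) j<1+l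
      ... | refl , 1+l-odd with rotation-move rot u (odd⇒suc-even (suc l) 1+l-odd)
      ...   | a , a∉P , _ =
        _ , o , subst (NimIs ((a , false) ∷ P)) (odd⇒suc-even (suc l) 1+l-odd) (option-nim o)
        where o = (a , false) , a∉P , rotations-¬Generates (refl ∷ rot) , refl

      options : ∀ Q → Option P Q → Σ[ j ∈ ℕ ] NimIs Q j × j ≢ suc l % 2
      options _ ((a , true) , _ , ¬gen , refl) =
        contradiction (indexGcd≡1+reflection-generate rot gcd≡1 a) ¬gen
      options _ o@((a , false) , _ , _ , refl) = l % 2 , option-nim o , ≢-sym (parity-suc-≢ l)

    rotation1-option : ∀ {P} → All IsRotation P → 1 < indexGcd P → Unique P →
                       HasOptionWithNim P (length P % 2)
    rotation1-option {P} rot 1<d u =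
      rotation 1 ∷ P , (rotation 1 , r∉P , rotations-¬Generates (refl ∷ rot) , refl) ,
      nim-rotations-full (⊏-wellFounded _) (refl ∷ rot) (gcd-zeroˡ (indexGcd P)) (unique-∷ r∉P u)
      where
      r∉P : rotation 1 ∉ P
      r∉P r∈P = <-irrefl (sym (∣1⇒≡1 (All.lookup (indexGcd-∣index P) r∈P))) 1<d

    reflection-option : ∀ {P} → All IsRotation P → 1 < indexGcd P → Unique P →
                        HasOptionWithNim P (suc (length P) % 2)
    reflection-option {P} rot 1<d u =
      f ∷ P , (f , f∉P , f-¬gen , refl) , nim-reflection (Fin.zero , here refl) (unique-∷ f∉P u) f-¬gen
      where
      f : D N
      f = Fin.zero , true
      f∉P : f ∉ P
      f∉P f∈P with () ← All.lookup rot f∈P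
      f-¬gen : ¬ Generates (f ∷ P)
      f-¬gen = multiples-¬Generates 1<d (indexGcd-∣N P) (indexGcd P ∣0 ∷ indexGcd-∣index P)

    options-below-2 : ∀ {P j} → All IsRotation P → 1 < indexGcd P → Unique P → j < 2 →
                      HasOptionWithNim P j
    options-below-2 {P} rot 1<d u j<2 with <2⇒parity (length P) j<2
    ... | inj₁ refl = rotation1-option rot 1<d u
    ... | inj₂ refl = reflection-option rot 1<d u

    nim-rotations-proper : ∀ {P} → Acc _⊏_ P → All IsRotation P → 1 < indexGcd P → Unique P →
                           NimIs P (2 + suc (length P) % 2)
    nim-rotations-proper {P} (acc rs) rot 1<d u = nimIs below options
      where
      l = length P

      proper-option-nim : ∀ {a} (o : Option P ((a , false) ∷ P)) → 1 < indexGcd ((a , false) ∷ P) →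
                          NimIs ((a , false) ∷ P) (2 + l % 2)
      proper-option-nim o@(_ , a∉P , _ , refl) 1<d′ =
        nim-rotations-proper (rs o) (refl ∷ rot) 1<d′ (unique-∷ a∉P u)

      below : ∀ j → j < 2 + suc l % 2 → HasOptionWithNim P j
      below (suc (suc j)) (s≤s (s≤s j<1+l)) with <-parity (suc l) j<1+l
      ... | refl , 1+l-odd with rotation-move rot u (odd⇒suc-even (suc l) 1+l-odd)
      ...   | a , a∉P , d∣a =
        _ , o , subst (λ v → NimIs ((a , false) ∷ P) (2 + v)) (odd⇒suc-even (suc l) 1+l-odd)
                  (proper-option-nim o 1<d′)
        where
        o = (a , false) , a∉P , rotations-¬Generates (refl ∷ rot) , refl
        1<d′ : 1 < gcd (toℕ a) (indexGcd P)
        1<d′ = subst (1 <_) (sym (∣-antisym (gcd[m,n]∣n (toℕ a) _) (gcd-greatest d∣a ∣-refl))) 1<d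
      below 0 _ = options-below-2 rot 1<d u (s≤s z≤n)
      below 1 _ = options-below-2 rot 1<d u (s≤s (s≤s z≤n))

      options : ∀ Q → Option P Q → Σ[ j ∈ ℕ ] NimIs Q j × j ≢ 2 + suc l % 2
      options _ ((a , true) , a∉P , ¬gen , refl) =
        suc l % 2 , nim-reflection (a , here refl) (unique-∷ a∉P u) ¬gen , m≢1+n+m (suc l % 2)
      options _ o@((a , false) , a∉P , _ , refl) with indexGcd-cases ((a , false) ∷ P)
      ... | inj₁ gcd≡1 = l % 2 , nim-rotations-full (⊏-wellFounded _) (refl ∷ rot) gcd≡1 (unique-∷ a∉P u) ,
                         <⇒≢ (<-≤-trans (m%n<n l 2) (m≤m+n 2 (suc l % 2)))
      ... | inj₂ 1<d′  =
        2 + l % 2 , proper-option-nim o 1<d′ , λ eq → parity-suc-≢ l (sym (cong (_∸ 2) eq))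

    nim[]≡3 : NimIs {N} [] 3
    nim[]≡3 = nim-rotations-proper (⊏-wellFounded []) [] (s≤s (s≤s z≤n)) []

corollary7p5 : (n : ℕ) → 2 ≤ n →
    (n % 2 ≡ 1 → (m : ℕ) → NimIs {n} [] m ⇔ m ≡ 3)
    × (n % 2 ≡ 0 → (m : ℕ) → NimIs {n} [] m ⇔ m ≡ 0)
corollary7p5 (suc (suc k)) (s≤s (s≤s z≤n)) =
  (λ odd → NimIs-⇔ (OddOrder.nim[]≡3 odd)) , (λ even → NimIs-⇔ (EvenOrder.nim[]≡0 even))
  where open AvoidanceGame k
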